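{- Let $n\geq 2$ be an integer and let $B$ be a non-empty subset of $U(n)$. Then $C_{\mathbb Z_n',B}(n)=4$ and $D_{\mathbb Z_n',B}(n)=3$.
   Context: $\mathbb Z_n=\mathbb Z/n\mathbb Z$ as a module over itself, $\mathbb Z_n'=\mathbb Z_n\setminus\{0\}$, $U(n)$ the group of units of $\mathbb Z_n$. A subsequence is a non-empty subfamily of terms in the original order. A sequence $(x_1,\ldots,x_k)$ is an $(A,B)$-weighted zero-sum sequence if there exist $a_i\in A$, $b_i\in B$ with $\sum a_ix_i=0$ and $\sum b_ia_i=0$. $C_{A,B}(n)$ is the least positive $k$ such that every sequence of length $k$ in $\mathbb Z_n$ has an $(A,B)$-weighted zero-sum subsequence having consecutive terms (a non-empty block $(x_i,\ldots,x_j)$); $D_{A,B}(n)$ is the least positive $k$ such that every sequence of length $k$ in $\mathbb Z_n$ has an $(A,B)$-weighted zero-sum subsequence. -}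

module Defs where

open import Data.Nat using (ℕ; _*_; _≤_; _<_)
open import Data.Nat.Divisibility using (_∣_)
open import Data.Nat.ListAction using (sum)
open import Data.Fin using (Fin; toℕ)
open import Data.List using (List; []; _∷_; _++_; length; zipWith)
open import Data.List.Relation.Unary.All using (All)
open import Data.List.Relation.Binary.Sublist.Propositional using (_⊆_)
open import Data.Product using (Σ; ∃; _×_)
open import Relation.Binary.PropositionalEquality using (_≡_; _≢_)
open import Relation.Nullary using (¬_)

-- Elements of ℤ_n are represented by Fin n (residues 0..n-1);
-- arithmetic is done on representatives in ℕ and congruence mod n is  n ∣ _.

dot : ∀ {n} → List (Fin n) → List (Fin n) → ℕ
dot us vs = sum (zipWith (λ u v → toℕ u * toℕ v) us vs)

Nonzero : ∀ {n} → Fin n → Set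
Nonzero a = toℕ a ≢ 0

IsUnit : ∀ {n} → Fin n → Set
IsUnit {n} b = Coprime (toℕ b) n
  where open import Data.Nat.Coprimality using (Coprime)

IsWZS : (n : ℕ) → (Fin n → Set) → (Fin n → Set) → List (Fin n) → Set
IsWZS n A B xs =
  Σ (List (Fin n)) λ as → Σ (List (Fin n)) λ bs →
    length as ≡ length xs × length bs ≡ length xs ×
    All A as × All B bs ×
    n ∣ dot as xs × n ∣ dot bs as

NonEmpty : ∀ {X : Set} → List X → Set
NonEmpty xs = xs ≢ []

HasWZSSub : (n : ℕ) → (Fin n → Set) → (Fin n → Set) → List (Fin n) → Set
HasWZSSub n A B xs =
  Σ (List (Fin n)) λ ys → ys ⊆ xs × NonEmpty ys × IsWZS n A B ys

HasWZSBlock : (n : ℕ) → (Fin n → Set) → (Fin n → Set) → List (Fin n) → Set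
HasWZSBlock n A B xs =
  Σ (List (Fin n)) λ pre → Σ (List (Fin n)) λ ys → Σ (List (Fin n)) λ suf →
    xs ≡ pre ++ ys ++ suf × NonEmpty ys × IsWZS n A B ys

CProp : (n : ℕ) → (Fin n → Set) → (Fin n → Set) → ℕ → Set
CProp n A B k = (xs : List (Fin n)) → length xs ≡ k → HasWZSBlock n A B xs

DProp : (n : ℕ) → (Fin n → Set) → (Fin n → Set) → ℕ → Set
DProp n A B k = (xs : List (Fin n)) → length xs ≡ k → HasWZSSub n A B xs

IsLeastPositive : (ℕ → Set) → ℕ → Set
IsLeastPositive P k = 1 ≤ k × P k × (∀ m → 1 ≤ m → m < k → ¬ P m)

C-is : (n : ℕ) → (Fin n → Set) → (Fin n → Set) → ℕ → Set
C-is n A B k = IsLeastPositive (CProp n A B) k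

D-is : (n : ℕ) → (Fin n → Set) → (Fin n → Set) → ℕ → Set
D-is n A B k = IsLeastPositive (DProp n A B) k

-- A weighting (aᵢ) of (xᵢ) by non-zero residues with Σ aᵢ ≡ 0 and Σ aᵢ xᵢ ≡ 0, together
-- with a constant unit weight b, witnesses a (ℤₙ', B)-weighted zero-sum sequence. Such
-- weightings exist for (x, x) and (x, y, x, y) (weights +1 on the first copy, −1 on the
-- second) and for three distinct terms (the cyclic differences x₂ − x₃, x₃ − x₁, x₁ − x₂).
-- Every sequence of length 4 has one of these shapes as a block, and every sequence of
-- length 3 one of them as a subsequence. Conversely b a ≢ 0 for a unit b and a ≢ 0, so a
-- single term is never a weighted zero-sum; nor is a sequence of zeros with a single 1,
-- whose weighted sum is the weight sitting at the 1. Hence (0, 1, 0) has no weighted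
-- zero-sum block and (0, 1) no weighted zero-sum subsequence.
module Submission where

open import Defs
open import Data.Nat using (ℕ; zero; suc; _+_; _*_; _∸_; _≤_; _<_; z≤n; s≤s; NonZero; ≢-nonZero)
open import Data.Nat.Properties
  using (suc-injective; +-assoc; +-comm; +-identityʳ; *-identityʳ; *-zeroʳ; *-distribˡ-+; *-distribʳ-+;
         <⇒≤; <⇒≱; m∸n+n≡m)
open import Data.Nat.DivMod
  using (_%_; _/_; _mod_; m≡m%n+[m/n]*n; m%n%n≡m%n; [m+n]%n≡m%n; [m+kn]%n≡m%n; m<n⇒m%n≡m;
         %-distribˡ-+; m%n<n; m*n%n≡0)
open import Data.Nat.Divisibility using (_∣_; divides; ∣⇒≤; ∣n⇒∣m*n; m∣m*n; n∣m*n; m%n≡0⇒n∣m)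
open import Data.Nat.Coprimality using (coprime-divisor) renaming (sym to coprime-sym)
open import Data.Nat.ListAction using (sum)
open import Data.Nat.ListAction.Properties using (sum-++)
open import Data.Nat.Tactic.RingSolver using (solve-∀)
open import Data.Fin using (Fin; toℕ; fromℕ; _≟_)
open import Data.Fin.Patterns using (0F; 1F)
open import Data.Fin.Properties using (toℕ<n; toℕ-fromℕ; toℕ-fromℕ<; toℕ-injective)
open import Data.List using (List; []; _∷_; _++_; length; map; replicate)
open import Data.List.Properties using (++-assoc; length-++; length-replicate; map-++)
open import Data.List.Relation.Unary.All using (All; []; _∷_)
import Data.List.Relation.Unary.All.Properties as All
open import Data.List.Relation.Binary.Sublist.Propositional using (_⊆_; []; _∷_; _∷ʳ_; ⊆-trans)
open import Data.Product using (∃; _×_; _,_)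
open import Relation.Nullary using (¬_; yes; no)
open import Relation.Binary.PropositionalEquality
open import Function using (_∘_)

sum-map-replicate : ∀ {A : Set} (f : A → ℕ) m x → sum (map f (replicate m x)) ≡ m * f x
sum-map-replicate f zero    x = refl
sum-map-replicate f (suc m) x = cong (f x +_) (sum-map-replicate f m x)

module _ {n : ℕ} where

  dot-replicate : (c : Fin n) (xs : List (Fin n)) →
    dot (replicate (length xs) c) xs ≡ toℕ c * sum (map toℕ xs)
  dot-replicate c []       = sym (*-zeroʳ (toℕ c))
  dot-replicate c (x ∷ xs) = trans (cong (toℕ c * toℕ x +_) (dot-replicate c xs))
                                   (sym (*-distribˡ-+ (toℕ c) (toℕ x) _))

  dot-++ : (as xs : List (Fin n)) {as′ xs′ : List (Fin n)} → length as ≡ length xs →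
    dot (as ++ as′) (xs ++ xs′) ≡ dot as xs + dot as′ xs′
  dot-++ []       []       refl = refl
  dot-++ (a ∷ as) (x ∷ xs) eq   =
    trans (cong (toℕ a * toℕ x +_) (dot-++ as xs (suc-injective eq)))
          (sym (+-assoc (toℕ a * toℕ x) _ _))

  dot-zeros : (as xs : List (Fin n)) → All (λ x → toℕ x ≡ 0) xs → dot as xs ≡ 0
  dot-zeros []       _        _          = refl
  dot-zeros (_ ∷ _)  []       []         = refl
  dot-zeros (a ∷ as) (x ∷ xs) (x≡0 ∷ zs) =
    cong₂ _+_ (trans (cong (toℕ a *_) x≡0) (*-zeroʳ (toℕ a))) (dot-zeros as xs zs)

  nonzero⇒∤ : {a : Fin n} → Nonzero a → ¬ n ∣ toℕ a
  nonzero⇒∤ {a} a≢0 n∣a = <⇒≱ (toℕ<n a) (∣⇒≤ {{≢-nonZero a≢0}} n∣a)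

  ¬∣dot-isolated-one : (as pre : List (Fin n)) {x : Fin n} {post : List (Fin n)} →
    length as ≡ length (pre ++ x ∷ post) → All Nonzero as →
    All (λ y → toℕ y ≡ 0) pre → toℕ x ≡ 1 → All (λ y → toℕ y ≡ 0) post →
    ¬ n ∣ dot as (pre ++ x ∷ post)
  ¬∣dot-isolated-one (a ∷ as) [] {post = post} _ (a≢0 ∷ _) [] x≡1 zs n∣dot =
    nonzero⇒∤ a≢0 (subst (n ∣_) dot≡a n∣dot)
    where
    dot≡a : dot (a ∷ as) (_ ∷ post) ≡ toℕ a
    dot≡a = trans (cong₂ _+_ (trans (cong (toℕ a *_) x≡1) (*-identityʳ (toℕ a)))
                             (dot-zeros as post zs))
                  (+-identityʳ (toℕ a))
  ¬∣dot-isolated-one (a ∷ as) (p ∷ pre) {x} {post} eq (_ ∷ nzs) (p≡0 ∷ zs) x≡1 zs′ n∣dot =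
    ¬∣dot-isolated-one as pre (suc-injective eq) nzs zs x≡1 zs′
      (subst (n ∣_) (cong (_+ dot as (pre ++ x ∷ post)) (trans (cong (toℕ a *_) p≡0) (*-zeroʳ (toℕ a))))
             n∣dot)

  module _ {A B : Fin n → Set} where

    -- The second zero-sum condition becomes b · Σ aᵢ ≡ 0 when all bᵢ equal b.
    IsWZS-uniform : {b : Fin n} → B b → (as xs : List (Fin n)) →
      length as ≡ length xs → All A as →
      n ∣ dot as xs → n ∣ sum (map toℕ as) → IsWZS n A B xs
    IsWZS-uniform {b} b∈B as xs as≡xs as∈A n∣dot n∣sum =
      as , replicate (length as) b , as≡xs , trans (length-replicate (length as)) as≡xs ,
      as∈A , All.replicate⁺ (length as) b∈B , n∣dot ,
      subst (n ∣_) (sym (dot-replicate b as)) (∣n⇒∣m*n (toℕ b) n∣sum)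

    HasWZSSub-mono : {xs ys : List (Fin n)} → xs ⊆ ys →
      HasWZSSub n A B xs → HasWZSSub n A B ys
    HasWZSSub-mono xs⊆ys (zs , zs⊆xs , ne , w) = zs , ⊆-trans zs⊆xs xs⊆ys , ne , w

    HasWZSBlock-++ : (xs zs : List (Fin n)) → HasWZSBlock n A B xs → HasWZSBlock n A B (xs ++ zs)
    HasWZSBlock-++ xs zs (pre , ys , suf , refl , ne , w) =
      pre , ys , suf ++ zs ,
      trans (++-assoc pre (ys ++ suf) zs) (cong (pre ++_) (++-assoc ys suf zs)) , ne , w

  module _ {B : Fin n → Set} where

    ¬IsWZS-singleton : (∀ b → B b → IsUnit b) → (x : Fin n) → ¬ IsWZS n Nonzero B (x ∷ [])
    ¬IsWZS-singleton B⊆U x (a ∷ [] , b ∷ [] , _ , _ , a≢0 ∷ [] , b∈B ∷ [] , _ , n∣ba) =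
      nonzero⇒∤ a≢0 (coprime-divisor (coprime-sym (B⊆U b b∈B)) (subst (n ∣_) (+-identityʳ _) n∣ba))

    ¬IsWZS-isolated-one : (pre : List (Fin n)) {x : Fin n} {post : List (Fin n)} →
      All (λ y → toℕ y ≡ 0) pre → toℕ x ≡ 1 → All (λ y → toℕ y ≡ 0) post →
      ¬ IsWZS n Nonzero B (pre ++ x ∷ post)
    ¬IsWZS-isolated-one pre zs x≡1 zs′ (as , _ , as≡xs , _ , as≢0 , _ , n∣dot , _) =
      ¬∣dot-isolated-one as pre as≡xs as≢0 zs x≡1 zs′ n∣dot

∣m+[n∸o]⇒m≡o : ∀ {m n o} .{{_ : NonZero n}} → m < n → o < n → n ∣ m + (n ∸ o) → m ≡ o
∣m+[n∸o]⇒m≡o {m} {n} {o} m<n o<n (divides q m+[n∸o]≡qn) = begin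
  m                 ≡⟨ m<n⇒m%n≡m m<n ⟨
  m % n             ≡⟨ [m+n]%n≡m%n m n ⟨
  (m + n) % n       ≡⟨ cong (_% n) m+n≡o+qn ⟩
  (o + q * n) % n   ≡⟨ [m+kn]%n≡m%n o q n ⟩
  o % n             ≡⟨ m<n⇒m%n≡m o<n ⟩
  o                 ∎
  where
  open ≡-Reasoning
  m+n≡o+qn : m + n ≡ o + q * n
  m+n≡o+qn = begin
    m + n             ≡⟨ cong (m +_) (m∸n+n≡m (<⇒≤ o<n)) ⟨
    m + (n ∸ o + o)   ≡⟨ +-assoc m (n ∸ o) o ⟨
    m + (n ∸ o) + o   ≡⟨ cong (_+ o) m+[n∸o]≡qn ⟩
    q * n + o         ≡⟨ +-comm (q * n) o ⟩
    o + q * n         ∎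

module _ {n : ℕ} .{{_ : NonZero n}} where

  %-absorbˡ-+ : ∀ m o → (m % n + o) % n ≡ (m + o) % n
  %-absorbˡ-+ m o = begin
    (m % n + o) % n           ≡⟨ %-distribˡ-+ (m % n) o n ⟩
    (m % n % n + o % n) % n   ≡⟨ cong (λ r → (r + o % n) % n) (m%n%n≡m%n m n) ⟩
    (m % n + o % n) % n       ≡⟨ %-distribˡ-+ m o n ⟨
    (m + o) % n               ∎
    where open ≡-Reasoning

  %-absorbˡ-*-+ : ∀ m o p → (m % n * o + p) % n ≡ (m * o + p) % n
  %-absorbˡ-*-+ m o p = sym (begin
    (m * o + p) % n                         ≡⟨ cong (λ r → (r * o + p) % n) (m≡m%n+[m/n]*n m n) ⟩
    ((m % n + m / n * n) * o + p) % n       ≡⟨ cong (_% n) (regroup (m % n) (m / n) n o p) ⟩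
    (m % n * o + p + m / n * o * n) % n     ≡⟨ [m+kn]%n≡m%n (m % n * o + p) (m / n * o) n ⟩
    (m % n * o + p) % n                     ∎)
    where
    open ≡-Reasoning
    regroup : ∀ r q d o p → (r + q * d) * o + p ≡ r * o + p + q * o * d
    regroup = solve-∀

  +-congˡ-% : ∀ m {o p} → o % n ≡ p % n → (m + o) % n ≡ (m + p) % n
  +-congˡ-% m {o} {p} o≡p = begin
    (m + o) % n           ≡⟨ %-distribˡ-+ m o n ⟩
    (m % n + o % n) % n   ≡⟨ cong (λ r → (m % n + r) % n) o≡p ⟩
    (m % n + p % n) % n   ≡⟨ %-distribˡ-+ m p n ⟨
    (m + p) % n           ∎
    where open ≡-Reasoning

  -- Adding n ∸ y rather than subtracting y avoids truncated subtraction.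
  _⊖_ : Fin n → Fin n → Fin n
  x ⊖ y = (toℕ x + (n ∸ toℕ y)) mod n

  toℕ-⊖ : ∀ x y → toℕ (x ⊖ y) ≡ (toℕ x + (n ∸ toℕ y)) % n
  toℕ-⊖ x y = toℕ-fromℕ< (m%n<n _ n)

  ⊖-nonzero : ∀ {x y} → x ≢ y → Nonzero (x ⊖ y)
  ⊖-nonzero {x} {y} x≢y x⊖y≡0 = x≢y (toℕ-injective
    (∣m+[n∸o]⇒m≡o (toℕ<n x) (toℕ<n y) (m%n≡0⇒n∣m _ n (trans (sym (toℕ-⊖ x y)) x⊖y≡0))))

-- cᵢ stands for n − xᵢ: these are Σ (xᵢ₊₁ − xᵢ₊₂) xᵢ = 0 and Σ (xᵢ₊₁ − xᵢ₊₂) = 0 without subtraction.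
module _ {n : ℕ} (x₁ x₂ x₃ c₁ c₂ c₃ : ℕ) (e₁ : c₁ + x₁ ≡ n) (e₂ : c₂ + x₂ ≡ n) (e₃ : c₃ + x₃ ≡ n) where

  cyclic-dot : (x₂ + c₃) * x₁ + ((x₃ + c₁) * x₂ + ((x₁ + c₂) * x₃ + 0)) ≡ (x₁ + x₂ + x₃) * n
  cyclic-dot = begin
    (x₂ + c₃) * x₁ + ((x₃ + c₁) * x₂ + ((x₁ + c₂) * x₃ + 0))
      ≡⟨ regroup x₁ x₂ x₃ c₁ c₂ c₃ ⟩
    x₁ * (c₃ + x₃) + x₂ * (c₁ + x₁) + x₃ * (c₂ + x₂)
      ≡⟨ cong₂ _+_ (cong₂ _+_ (cong (x₁ *_) e₃) (cong (x₂ *_) e₁)) (cong (x₃ *_) e₂) ⟩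
    x₁ * n + x₂ * n + x₃ * n
      ≡⟨ *-distribʳ-+₃ x₁ x₂ x₃ n ⟩
    (x₁ + x₂ + x₃) * n ∎
    where
    open ≡-Reasoning
    regroup : ∀ x₁ x₂ x₃ c₁ c₂ c₃ → (x₂ + c₃) * x₁ + ((x₃ + c₁) * x₂ + ((x₁ + c₂) * x₃ + 0))
                                  ≡ x₁ * (c₃ + x₃) + x₂ * (c₁ + x₁) + x₃ * (c₂ + x₂)
    regroup = solve-∀
    *-distribʳ-+₃ : ∀ x₁ x₂ x₃ d → x₁ * d + x₂ * d + x₃ * d ≡ (x₁ + x₂ + x₃) * d
    *-distribʳ-+₃ = solve-∀

  cyclic-sum : (x₂ + c₃) + ((x₃ + c₁) + ((x₁ + c₂) + 0)) ≡ 3 * n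
  cyclic-sum = begin
    (x₂ + c₃) + ((x₃ + c₁) + ((x₁ + c₂) + 0))
      ≡⟨ regroup x₁ x₂ x₃ c₁ c₂ c₃ ⟩
    (c₁ + x₁) + (c₂ + x₂) + (c₃ + x₃)
      ≡⟨ cong₂ _+_ (cong₂ _+_ e₁ e₂) e₃ ⟩
    n + n + n
      ≡⟨ triple n ⟩
    3 * n ∎
    where
    open ≡-Reasoning
    regroup : ∀ x₁ x₂ x₃ c₁ c₂ c₃ → (x₂ + c₃) + ((x₃ + c₁) + ((x₁ + c₂) + 0))
                                  ≡ (c₁ + x₁) + (c₂ + x₂) + (c₃ + x₃)
    regroup = solve-∀
    triple : ∀ d → d + d + d ≡ 3 * d
    triple = solve-∀

module _ {n : ℕ} .{{_ : NonZero n}} {B : Fin n → Set} {b : Fin n} (b∈B : B b) where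

  IsWZS-distinct-triple : ∀ {x₁ x₂ x₃} → x₁ ≢ x₂ → x₂ ≢ x₃ → x₁ ≢ x₃ →
    IsWZS n Nonzero B (x₁ ∷ x₂ ∷ x₃ ∷ [])
  IsWZS-distinct-triple {x₁} {x₂} {x₃} x₁≢x₂ x₂≢x₃ x₁≢x₃ =
    IsWZS-uniform b∈B (x₂ ⊖ x₃ ∷ x₃ ⊖ x₁ ∷ x₁ ⊖ x₂ ∷ []) _ refl
      (⊖-nonzero x₂≢x₃ ∷ ⊖-nonzero (x₁≢x₃ ∘ sym) ∷ ⊖-nonzero x₁≢x₂ ∷ [])
      n∣dot n∣sum
    where
    open ≡-Reasoning
    t₁ = toℕ x₁
    t₂ = toℕ x₂
    t₃ = toℕ x₃
    E₁ = t₂ + (n ∸ t₃)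
    E₂ = t₃ + (n ∸ t₁)
    E₃ = t₁ + (n ∸ t₂)
    c+t≡n : ∀ x → n ∸ toℕ x + toℕ x ≡ n
    c+t≡n x = m∸n+n≡m (<⇒≤ (toℕ<n x))

    n∣dot : n ∣ dot (x₂ ⊖ x₃ ∷ x₃ ⊖ x₁ ∷ x₁ ⊖ x₂ ∷ []) (x₁ ∷ x₂ ∷ x₃ ∷ [])
    n∣dot rewrite toℕ-⊖ x₂ x₃ | toℕ-⊖ x₃ x₁ | toℕ-⊖ x₁ x₂ = m%n≡0⇒n∣m _ n (begin
      (E₁ % n * t₁ + (E₂ % n * t₂ + (E₃ % n * t₃ + 0))) % n
        ≡⟨ %-absorbˡ-*-+ E₁ t₁ _ ⟩
      (E₁ * t₁ + (E₂ % n * t₂ + (E₃ % n * t₃ + 0))) % n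
        ≡⟨ +-congˡ-% (E₁ * t₁) (%-absorbˡ-*-+ E₂ t₂ _) ⟩
      (E₁ * t₁ + (E₂ * t₂ + (E₃ % n * t₃ + 0))) % n
        ≡⟨ +-congˡ-% (E₁ * t₁) (+-congˡ-% (E₂ * t₂) (%-absorbˡ-*-+ E₃ t₃ 0)) ⟩
      (E₁ * t₁ + (E₂ * t₂ + (E₃ * t₃ + 0))) % n
        ≡⟨ cong (_% n) (cyclic-dot t₁ t₂ t₃ _ _ _ (c+t≡n x₁) (c+t≡n x₂) (c+t≡n x₃)) ⟩
      (t₁ + t₂ + t₃) * n % n
        ≡⟨ m*n%n≡0 (t₁ + t₂ + t₃) n ⟩
      0 ∎)

    n∣sum : n ∣ sum (map toℕ (x₂ ⊖ x₃ ∷ x₃ ⊖ x₁ ∷ x₁ ⊖ x₂ ∷ []))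
    n∣sum rewrite toℕ-⊖ x₂ x₃ | toℕ-⊖ x₃ x₁ | toℕ-⊖ x₁ x₂ = m%n≡0⇒n∣m _ n (begin
      (E₁ % n + (E₂ % n + (E₃ % n + 0))) % n
        ≡⟨ %-absorbˡ-+ E₁ _ ⟩
      (E₁ + (E₂ % n + (E₃ % n + 0))) % n
        ≡⟨ +-congˡ-% E₁ (%-absorbˡ-+ E₂ _) ⟩
      (E₁ + (E₂ + (E₃ % n + 0))) % n
        ≡⟨ +-congˡ-% E₁ (+-congˡ-% E₂ (%-absorbˡ-+ E₃ 0)) ⟩
      (E₁ + (E₂ + (E₃ + 0))) % n
        ≡⟨ cong (_% n) (cyclic-sum t₁ t₂ t₃ _ _ _ (c+t≡n x₁) (c+t≡n x₂) (c+t≡n x₃)) ⟩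
      3 * n % n
        ≡⟨ m*n%n≡0 3 n ⟩
      0 ∎)

module _ {k : ℕ} {B : Fin (2 + k) → Set} {b : Fin (2 + k)} (b∈B : B b) where

  private
    −1F : Fin (2 + k)
    −1F = fromℕ (suc k)

  IsWZS-doubled : (xs : List (Fin (2 + k))) → IsWZS (2 + k) Nonzero B (xs ++ xs)
  IsWZS-doubled xs =
    IsWZS-uniform b∈B (ones ++ minusOnes) (xs ++ xs) length≡
      (All.++⁺ (All.replicate⁺ m λ ()) (All.replicate⁺ m λ ()))
      (subst (2 + k ∣_) (sym dot≡) (m∣m*n S))
      (subst (2 + k ∣_) (sym sum≡) (n∣m*n m))
    where
    open ≡-Reasoning
    m = length xs
    S = sum (map toℕ xs)
    ones minusOnes : List (Fin (2 + k))
    ones = replicate m 1F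
    minusOnes = replicate m −1F

    length≡ : length (ones ++ minusOnes) ≡ length (xs ++ xs)
    length≡ = trans (length-++ ones)
                    (trans (cong₂ _+_ (length-replicate m) (length-replicate m)) (sym (length-++ xs)))

    dot≡ : dot (ones ++ minusOnes) (xs ++ xs) ≡ (2 + k) * S
    dot≡ = begin
      dot (ones ++ minusOnes) (xs ++ xs)   ≡⟨ dot-++ ones xs (length-replicate m) ⟩
      dot ones xs + dot minusOnes xs       ≡⟨ cong₂ _+_ (dot-replicate 1F xs) (dot-replicate −1F xs) ⟩
      1 * S + toℕ −1F * S                  ≡⟨ cong (λ c → 1 * S + c * S) (toℕ-fromℕ (suc k)) ⟩
      1 * S + suc k * S                    ≡⟨ *-distribʳ-+ S 1 (suc k) ⟨
      (2 + k) * S                          ∎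

    sum≡ : sum (map toℕ (ones ++ minusOnes)) ≡ m * (2 + k)
    sum≡ = begin
      sum (map toℕ (ones ++ minusOnes))          ≡⟨ cong sum (map-++ toℕ ones minusOnes) ⟩
      sum (map toℕ ones ++ map toℕ minusOnes)    ≡⟨ sum-++ (map toℕ ones) _ ⟩
      sum (map toℕ ones) + sum (map toℕ minusOnes)
        ≡⟨ cong₂ _+_ (sum-map-replicate toℕ m 1F) (sum-map-replicate toℕ m −1F) ⟩
      m * 1 + m * toℕ −1F                        ≡⟨ cong (λ c → m * 1 + m * c) (toℕ-fromℕ (suc k)) ⟩
      m * 1 + m * suc k                          ≡⟨ *-distribˡ-+ m 1 (suc k) ⟨
      m * (2 + k)                                ∎

  CProp-4 : CProp (2 + k) Nonzero B 4
  CProp-4 (x₁ ∷ x₂ ∷ x₃ ∷ x₄ ∷ []) refl with x₁ ≟ x₂ | x₂ ≟ x₃ | x₃ ≟ x₄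
  ... | yes refl | _        | _        = [] , x₁ ∷ x₁ ∷ [] , x₃ ∷ x₄ ∷ [] , refl , (λ ()) , IsWZS-doubled (x₁ ∷ [])
  ... | no _     | yes refl | _        = x₁ ∷ [] , x₂ ∷ x₂ ∷ [] , x₄ ∷ [] , refl , (λ ()) , IsWZS-doubled (x₂ ∷ [])
  ... | no _     | no _     | yes refl = x₁ ∷ x₂ ∷ [] , x₃ ∷ x₃ ∷ [] , [] , refl , (λ ()) , IsWZS-doubled (x₃ ∷ [])
  ... | no x₁≢x₂ | no x₂≢x₃ | no x₃≢x₄ with x₁ ≟ x₃ | x₂ ≟ x₄
  ...   | no x₁≢x₃ | _        = [] , x₁ ∷ x₂ ∷ x₃ ∷ [] , x₄ ∷ [] , refl , (λ ()) ,
                                IsWZS-distinct-triple b∈B x₁≢x₂ x₂≢x₃ x₁≢x₃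
  ...   | yes refl | no x₂≢x₄ = x₁ ∷ [] , x₂ ∷ x₁ ∷ x₄ ∷ [] , [] , refl , (λ ()) ,
                                IsWZS-distinct-triple b∈B (x₁≢x₂ ∘ sym) x₃≢x₄ x₂≢x₄
  ...   | yes refl | yes refl = [] , x₁ ∷ x₂ ∷ x₁ ∷ x₂ ∷ [] , [] , refl , (λ ()) , IsWZS-doubled (x₁ ∷ x₂ ∷ [])

  DProp-3 : DProp (2 + k) Nonzero B 3
  DProp-3 (x₁ ∷ x₂ ∷ x₃ ∷ []) refl with x₁ ≟ x₂ | x₂ ≟ x₃ | x₁ ≟ x₃
  ... | yes refl | _        | _        = x₁ ∷ x₁ ∷ [] , refl ∷ refl ∷ x₃ ∷ʳ [] , (λ ()) , IsWZS-doubled (x₁ ∷ [])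
  ... | no _     | yes refl | _        = x₂ ∷ x₂ ∷ [] , x₁ ∷ʳ refl ∷ refl ∷ [] , (λ ()) , IsWZS-doubled (x₂ ∷ [])
  ... | no _     | no _     | yes refl = x₁ ∷ x₁ ∷ [] , refl ∷ x₂ ∷ʳ refl ∷ [] , (λ ()) , IsWZS-doubled (x₁ ∷ [])
  ... | no x₁≢x₂ | no x₂≢x₃ | no x₁≢x₃ = x₁ ∷ x₂ ∷ x₃ ∷ [] , refl ∷ refl ∷ refl ∷ [] , (λ ()) ,
                                         IsWZS-distinct-triple b∈B x₁≢x₂ x₂≢x₃ x₁≢x₃

module _ {k : ℕ} {B : Fin (2 + k) → Set} (B⊆U : ∀ b → B b → IsUnit b) where

  ¬HasWZSSub-01 : ¬ HasWZSSub (2 + k) Nonzero B (0F ∷ 1F ∷ [])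
  ¬HasWZSSub-01 (_ , _ ∷ʳ _ ∷ʳ []       , ne , _) = ne refl
  ¬HasWZSSub-01 (_ , _ ∷ʳ refl ∷ []     , _  , w) = ¬IsWZS-isolated-one [] [] refl [] w
  ¬HasWZSSub-01 (_ , refl ∷ _ ∷ʳ []     , _  , w) = ¬IsWZS-singleton B⊆U 0F w
  ¬HasWZSSub-01 (_ , refl ∷ refl ∷ []   , _  , w) = ¬IsWZS-isolated-one (0F ∷ []) (refl ∷ []) refl [] w

  ¬HasWZSBlock-010 : ¬ HasWZSBlock (2 + k) Nonzero B (0F ∷ 1F ∷ 0F ∷ [])
  ¬HasWZSBlock-010 (_ , [] , _ , _ , ne , _) = ne refl
  ¬HasWZSBlock-010 (_ , y ∷ [] , _ , _ , _ , w) = ¬IsWZS-singleton B⊆U y w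
  ¬HasWZSBlock-010 ([] , _ ∷ _ ∷ [] , _ , refl , _ , w) =
    ¬IsWZS-isolated-one (0F ∷ []) (refl ∷ []) refl [] w
  ¬HasWZSBlock-010 ([] , _ ∷ _ ∷ _ ∷ [] , _ , refl , _ , w) =
    ¬IsWZS-isolated-one (0F ∷ []) (refl ∷ []) refl (refl ∷ []) w
  ¬HasWZSBlock-010 (_ ∷ [] , _ ∷ _ ∷ [] , _ , refl , _ , w) =
    ¬IsWZS-isolated-one [] [] refl (refl ∷ []) w
  ¬HasWZSBlock-010 ([] , _ ∷ _ ∷ _ ∷ _ ∷ _ , _ , () , _)
  ¬HasWZSBlock-010 (_ ∷ [] , _ ∷ _ ∷ _ ∷ _ , _ , () , _)
  ¬HasWZSBlock-010 (_ ∷ _ ∷ [] , _ ∷ _ ∷ _ , _ , () , _)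
  ¬HasWZSBlock-010 (_ ∷ _ ∷ _ ∷ [] , _ ∷ _ ∷ _ , _ , () , _)
  ¬HasWZSBlock-010 (_ ∷ _ ∷ _ ∷ _ ∷ _ , _ ∷ _ ∷ _ , _ , () , _)

  ¬CProp<4 : ∀ m → 1 ≤ m → m < 4 → ¬ CProp (2 + k) Nonzero B m
  ¬CProp<4 1 _ _ C = ¬HasWZSBlock-010 (HasWZSBlock-++ (0F ∷ []) (1F ∷ 0F ∷ []) (C _ refl))
  ¬CProp<4 2 _ _ C = ¬HasWZSBlock-010 (HasWZSBlock-++ (0F ∷ 1F ∷ []) (0F ∷ []) (C _ refl))
  ¬CProp<4 3 _ _ C = ¬HasWZSBlock-010 (C _ refl)
  ¬CProp<4 (suc (suc (suc (suc _)))) _ (s≤s (s≤s (s≤s (s≤s ()))))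

  ¬DProp<3 : ∀ m → 1 ≤ m → m < 3 → ¬ DProp (2 + k) Nonzero B m
  ¬DProp<3 1 _ _ D = ¬HasWZSSub-01 (HasWZSSub-mono (refl ∷ 1F ∷ʳ []) (D (0F ∷ []) refl))
  ¬DProp<3 2 _ _ D = ¬HasWZSSub-01 (D _ refl)
  ¬DProp<3 (suc (suc (suc _))) _ (s≤s (s≤s (s≤s ())))

theorem24 : (n : ℕ) → 2 ≤ n → (B : Fin n → Set) →
    (∀ b → B b → IsUnit b) → ∃ B →
    C-is n Nonzero B 4 × D-is n Nonzero B 3
theorem24 (suc (suc k)) (s≤s (s≤s z≤n)) B B⊆U (b , b∈B) =
  (s≤s z≤n , CProp-4 b∈B , ¬CProp<4 B⊆U) , (s≤s z≤n , DProp-3 b∈B , ¬DProp<3 B⊆U)
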